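{- Let $p,h,k$ be positive integers. There is a bijection between $\mathcal P_{(p,h,k)}=\bigcup_{\beta\in I_{(h,k)}}\mathcal P_{(p,h,k),\beta}$ and the set of stable monomial ideals $J\triangleleft\mathbf k[x_1,x_2,x_3]$ with $\mathsf N(J)$ finite whose Bar Code of $\mathsf N(J)$ has bar list $(p,h,k)$.
   Context: $\mathbf k$ is a field of characteristic $0$; terms ordered lexicographically with $x_1<x_2<x_3$. A monomial ideal $J$ is stable if for every term $\tau\in J$ and every variable $x_j>\min(\tau)$ (smallest variable dividing $\tau$), $x_j\tau/\min(\tau)\in J$; $\mathsf N(J)$ is the set of terms not in $J$. The bar list of (the Bar Code of) a finite set $M$ of terms is $(\mu(1),\mu(2),\mu(3))$ with $\mu(1)=|M|$, $\mu(2)=|\{x_2^{\gamma_2}x_3^{\gamma_3}: x^\gamma\in M\}|$, $\mu(3)=|\{x_3^{\gamma_3}:x^\gamma\in M\}|$. $I_{(h,k)}$ is the set of $(\beta_1,\dots,\beta_k)\in\mathbb N^k$ with $\beta_1>\dots>\beta_k>0$, $\sum\beta_i=h$. For $\beta\in I_{(h,k)}$, $\mathcal P_{(p,h,k),\beta}$ is the set of integer arrays $\rho=(\rho_{i,j})_{1\le i\le k,\,1\le j\le\beta_i}$ (row- and column-strict plane partitions of shape $\beta$) with $\rho_{i,j}>0$, $\rho_{i,j}>\rho_{i,j+1}$ for $j<\beta_i$, $\rho_{i,j}>\rho_{i+1,j}$ for $i<k$, $j\le\beta_{i+1}$, and $\sum_{i,j}\rho_{i,j}=p$. -}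

module Defs where

open import Data.Nat using (ℕ; zero; suc; _<_; _>_)
open import Data.Nat.Properties using () renaming (_≟_ to _≟ℕ_)
open import Data.Bool using (Bool; true; false)
open import Data.Product using (Σ; ∃; _×_; _,_; proj₁; proj₂)
open import Data.Product.Properties using (≡-dec)
open import Data.List using (List; []; _∷_; length; map; deduplicate)
open import Data.Nat.ListAction using (sum)
open import Data.List.Relation.Unary.All using (All)
open import Data.List.Relation.Unary.Linked using (Linked)
open import Data.List.Relation.Unary.Unique.Propositional using (Unique)
open import Data.List.Membership.Propositional using (_∈_)
open import Data.Unit using (⊤)
open import Data.Empty using (⊥)
open import Relation.Binary.PropositionalEquality using (_≡_)
open import Relation.Binary.Definitions using (DecidableEquality)
open import Function.Bundles using (_⇔_)

-- A term x1^a x2^b x3^c of k[x1,x2,x3] is its exponent triple (a , b , c).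
-- Variables ordered x1 < x2 < x3.
Term : Set
Term = ℕ × ℕ × ℕ

_≟T_ : DecidableEquality Term
_≟T_ = ≡-dec _≟ℕ_ (≡-dec _≟ℕ_ _≟ℕ_)

-- A monomial ideal is given by its (decidable) set of terms J : Term → Bool,
-- which must be closed under multiplication by every variable.
IsMonomialIdeal : (Term → Bool) → Set
IsMonomialIdeal J =
  ∀ a b c → J (a , b , c) ≡ true →
    J (suc a , b , c) ≡ true × J (a , suc b , c) ≡ true × J (a , b , suc c) ≡ true

-- Stability: for τ ∈ J and every x_j > min(τ), x_j τ / min(τ) ∈ J.
--  * min(τ) = x1 when a > 0 : then x2 τ/x1 and x3 τ/x1 ∈ J;
--  * min(τ) = x2 when a = 0, b > 0 : then x3 τ/x2 ∈ J;
--  * min(τ) = x3 when a = b = 0, c > 0 : no larger variable, no condition;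
--  * τ = 1 has no variable dividing it: no condition.
IsStable : (Term → Bool) → Set
IsStable J =
  (∀ a b c → J (suc a , b , c) ≡ true →
     J (a , suc b , c) ≡ true × J (a , b , suc c) ≡ true)
  × (∀ b c → J (0 , suc b , c) ≡ true → J (0 , b , suc c) ≡ true)

proj23 : Term → ℕ × ℕ
proj23 (a , b , c) = (b , c)

proj3 : Term → ℕ
proj3 (a , b , c) = c

μ1 : List Term → ℕ
μ1 M = length M

μ2 : List Term → ℕ
μ2 M = length (deduplicate (≡-dec _≟ℕ_ _≟ℕ_) (map proj23 M))

μ3 : List Term → ℕ
μ3 M = length (deduplicate _≟ℕ_ (map proj3 M))

HasFiniteNWithBarList : (Term → Bool) → ℕ → ℕ → ℕ → Set
HasFiniteNWithBarList J p h k =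
  Σ (List Term) λ M →
    Unique M × (∀ t → (t ∈ M) ⇔ (J t ≡ false))
    × μ1 M ≡ p × μ2 M ≡ h × μ3 M ≡ k

StableIdeal : ℕ → ℕ → ℕ → Set
StableIdeal p h k =
  Σ (Term → Bool) λ J → IsMonomialIdeal J × IsStable J × HasFiniteNWithBarList J p h k

_≈J_ : ∀ {p h k} → StableIdeal p h k → StableIdeal p h k → Set
I ≈J J = ∀ t → proj₁ I t ≡ proj₁ J t

ColStrict : List ℕ → List ℕ → Set
ColStrict r [] = ⊤
ColStrict [] (_ ∷ _) = ⊥
ColStrict (a ∷ r) (b ∷ r') = b < a × ColStrict r r'

InI : ℕ → ℕ → List ℕ → Set
InI h k β = Linked _>_ β × All (0 <_) β × length β ≡ k × sum β ≡ h

-- ρ ∈ P_(p,h,k),β for some β ∈ I_(h,k); ρ is the list of its rows, β = row lengths.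
IsPP : ℕ → ℕ → ℕ → List (List ℕ) → Set
IsPP p h k ρ =
  InI h k (map length ρ)
  × All (All (0 <_)) ρ
  × All (Linked _>_) ρ
  × Linked ColStrict ρ
  × sum (map sum ρ) ≡ p

PP : ℕ → ℕ → ℕ → Set
PP p h k = Σ (List (List ℕ)) (IsPP p h k)

-- For a stable ideal J with N(J) finite, record for every pair (b , c) the least a
-- with x1^a x2^b x3^c ∈ J.  Since J is closed under multiplication by x1, this
-- threshold describes J completely, and it is positive exactly on the pairs (b , c)
-- with x2^b x3^c ∈ N(J).  Arranged as a table with one row per power of x3, stability
-- says precisely that these thresholds strictly decrease along rows and columns and
-- that the row lengths strictly decrease: the table is a row- and column-strict plane
-- partition of strict shape.  Its entries sum to |N(J)| = μ(1), it has one cell per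
-- distinct x2^b x3^c, i.e. μ(2) cells, and one row per distinct x3^c, i.e. μ(3) rows.

module Submission where

open import Defs
open import Data.Bool using (Bool; true; false; if_then_else_)
open import Data.Bool.Properties using (¬-not; not-¬; T-≡)
open import Data.Empty using (⊥-elim)
open import Data.List using (List; []; _∷_; length; map; _++_; upTo; applyUpTo; deduplicate)
open import Data.List.Membership.Propositional using (_∈_)
open import Data.List.Membership.Propositional.Properties
  using (∈-map⁺; ∈-map⁻; ∈-++⁺ˡ; ∈-++⁺ʳ; ∈-++⁻; ∈-upTo⁺; ∈-upTo⁻; deduplicate-∈⇔)
open import Data.List.Membership.Propositional.Properties.WithK using (unique∧set⇒bag)
open import Data.List.Properties using (length-++; length-map; length-upTo; length-applyUpTo; map-id)
open import Data.List.Relation.Binary.BagAndSetEquality using (_∼[_]_; set; ∼bag⇒↭; map-cong)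
open import Data.List.Relation.Binary.Permutation.Propositional.Properties using (↭-length)
open import Data.List.Relation.Unary.All using (All; []; _∷_)
import Data.List.Relation.Unary.All.Properties as All
open import Data.List.Relation.Unary.AllPairs using ([])
open import Data.List.Relation.Unary.Any using (here; there)
open import Data.List.Relation.Unary.Linked as Linked using (Linked; []; [-]; _∷_)
import Data.List.Relation.Unary.Linked.Properties as Linked
open import Data.List.Relation.Unary.Unique.Propositional using (Unique)
open import Data.List.Relation.Unary.Unique.Propositional.Properties using (++⁺; map⁺; upTo⁺)
open import Data.List.Relation.Unary.Unique.DecPropositional.Properties using (deduplicate-!)
open import Data.Nat
  using (ℕ; zero; suc; pred; _+_; _≤_; _<_; _>_; _≤ᵇ_; _≤′_; ≤′-reflexive; ≤′-step; z≤n; s≤s; s≤s⁻¹)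
open import Data.Nat.ListAction using (sum)
open import Data.Nat.Properties
open import Data.Product using (Σ; ∃; _×_; _,_; proj₁; proj₂)
open import Data.Product.Properties using (≡-dec)
open import Data.Sum using (inj₁; inj₂)
open import Data.Unit using (tt)
open import Function using (_∘_; id)
open import Function.Bundles using (_⇔_; mk⇔; Equivalence)
import Function.Properties.Equivalence as ⇔
open import Relation.Binary.Definitions using (DecidableEquality)
open import Relation.Binary.PropositionalEquality
open import Relation.Nullary using (¬_)

open Equivalence using (to; from)

private
  variable
    A B X : Set

length-unique : {xs ys : List A} → Unique xs → Unique ys → xs ∼[ set ] ys →
                length xs ≡ length ys
length-unique ux uy xs∼ys = ↭-length (∼bag⇒↭ (unique∧set⇒bag ux uy xs∼ys))

length-deduplicate : (_≟_ : DecidableEquality A) {xs ys : List A} →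
                     Unique ys → xs ∼[ set ] ys → length (deduplicate _≟_ xs) ≡ length ys
length-deduplicate _≟_ {xs} uy xs∼ys =
  length-unique (deduplicate-! _≟_ xs) uy (⇔.trans (⇔.sym (deduplicate-∈⇔ _≟_)) xs∼ys)

length-deduplicate-map-cong : (_≟_ : DecidableEquality B) (f : A → B) {xs ys : List A} →
  xs ∼[ set ] ys →
  length (deduplicate _≟_ (map f xs)) ≡ length (deduplicate _≟_ (map f ys))
length-deduplicate-map-cong _≟_ f {ys = ys} xs∼ys =
  length-deduplicate _≟_ (deduplicate-! _≟_ (map f ys))
    (⇔.trans (map-cong (λ _ → refl) xs∼ys) (deduplicate-∈⇔ _≟_))

∈⇒≤sum : ∀ {n ns} → n ∈ ns → n ≤ sum ns
∈⇒≤sum {ns = n ∷ ns} (here refl) = m≤m+n n (sum ns)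
∈⇒≤sum {ns = m ∷ ns} (there n∈ns) = ≤-trans (∈⇒≤sum n∈ns) (m≤n+m (sum ns) m)

-- Lists indexed by ℕ, padded with a default value

at : A → List A → ℕ → A
at d []       i       = d
at d (x ∷ xs) zero    = x
at d (x ∷ xs) (suc i) = at d xs i

at-map : (f : A → B) (d : A) (xs : List A) (i : ℕ) → at (f d) (map f xs) i ≡ f (at d xs i)
at-map f d []       i       = refl
at-map f d (x ∷ xs) zero    = refl
at-map f d (x ∷ xs) (suc i) = at-map f d xs i

All-at : {P : A → Set} {d : A} {xs : List A} → All P xs → P d → ∀ i → P (at d xs i)
All-at []         pd i       = pd
All-at (px ∷ pxs) pd zero    = px
All-at (px ∷ pxs) pd (suc i) = All-at pxs pd i

All-at-< : {P : A → Set} {d : A} {xs : List A} → All P xs → ∀ {i} → i < length xs →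
           P (at d xs i)
All-at-< (px ∷ pxs) {zero}  _   = px
All-at-< (px ∷ pxs) {suc i} i<n = All-at-< pxs (s≤s⁻¹ i<n)

at-<length : {P : A → Set} {d : A} (xs : List A) {i : ℕ} → ¬ P d → P (at d xs i) →
             i < length xs
at-<length []       ¬pd p = ⊥-elim (¬pd p)
at-<length (x ∷ xs) {zero}  ¬pd p = s≤s z≤n
at-<length {P = P} (x ∷ xs) {suc i} ¬pd p = s≤s (at-<length {P = P} xs ¬pd p)

Linked-at : {R : A → A → Set} {d : A} {xs : List A} → Linked R xs → (∀ x → R x d) →
            ∀ i → R (at d xs i) (at d xs (suc i))
Linked-at {d = d} []        Rd i       = Rd d
Linked-at {d = d} [-]       Rd zero    = Rd _
Linked-at {d = d} [-]       Rd (suc i) = Rd d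
Linked-at         (r ∷ rs)  Rd zero    = r
Linked-at         (r ∷ rs)  Rd (suc i) = Linked-at rs Rd i

at-ext : {P : A → Set} {d : A} {xs ys : List A} → ¬ P d → All P xs → All P ys →
         (∀ i → at d xs i ≡ at d ys i) → xs ≡ ys
at-ext ¬pd []         []         eq = refl
at-ext ¬pd []         (py ∷ _)   eq = ⊥-elim (¬pd (subst _ (sym (eq 0)) py))
at-ext ¬pd (px ∷ _)   []         eq = ⊥-elim (¬pd (subst _ (eq 0) px))
at-ext ¬pd (_ ∷ pxs)  (_ ∷ pys)  eq =
  cong₂ _∷_ (eq 0) (at-ext ¬pd pxs pys (eq ∘ suc))

at-applyUpTo : {f : ℕ → A} {d : A} (n : ℕ) → (∀ i → n ≤ i → f i ≡ d) →
               ∀ i → at d (applyUpTo f n) i ≡ f i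
at-applyUpTo zero    vanish i       = sym (vanish i z≤n)
at-applyUpTo (suc n) vanish zero    = refl
at-applyUpTo (suc n) vanish (suc i) =
  at-applyUpTo n (λ j n≤j → vanish (suc j) (s≤s n≤j)) i

Linked-applyUpTo : {R : A → A → Set} (f : ℕ → A) (n : ℕ) →
                   (∀ {i} → suc i < n → R (f i) (f (suc i))) → Linked R (applyUpTo f n)
Linked-applyUpTo f zero          step = []
Linked-applyUpTo f (suc zero)    step = [-]
Linked-applyUpTo f (suc (suc n)) step =
  step (s≤s (s≤s z≤n)) ∷ Linked-applyUpTo (f ∘ suc) (suc n) (step ∘ s≤s)

-- "m ≤ pred n" says m < n unless m = 0; unlike m < n it survives padding by zeros.
≤pred⇒< : ∀ {m n} → 0 < m → m ≤ pred n → m < n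
≤pred⇒< {n = zero}  0<m m≤0 = ⊥-elim (<⇒≱ 0<m m≤0)
≤pred⇒< {n = suc n} 0<m m≤n = s≤s m≤n

n≤suc[pred[n]] : ∀ n → n ≤ suc (pred n)
n≤suc[pred[n]] zero    = z≤n
n≤suc[pred[n]] (suc n) = ≤-refl

≤⇔≤⇒>⇔> : ∀ {m i n j} → (m ≤ i ⇔ n ≤ j) → (m > i ⇔ n > j)
≤⇔≤⇒>⇔> m≤i⇔n≤j = mk⇔ (λ m>i → ≰⇒> (<⇒≱ m>i ∘ from m≤i⇔n≤j))
                       (λ n>j → ≰⇒> (<⇒≱ n>j ∘ to m≤i⇔n≤j))

Linked>-at : {xs : List ℕ} → Linked _>_ xs → ∀ i → at 0 xs (suc i) ≤ pred (at 0 xs i)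
Linked>-at xs↓ = Linked-at (Linked.map suc[m]≤n⇒m≤pred[n] xs↓) (λ _ → z≤n)

ColStrict-at : (r r' : List ℕ) → ColStrict r r' → ∀ b → at 0 r' b ≤ pred (at 0 r b)
ColStrict-at r       []       _          b       = z≤n
ColStrict-at (x ∷ r) (y ∷ r') (y<x , _)  zero    = suc[m]≤n⇒m≤pred[n] y<x
ColStrict-at (x ∷ r) (y ∷ r') (_ , r'<r) (suc b) = ColStrict-at r r' r'<r b

ColStrict-applyUpTo : {f g : ℕ → ℕ} (m n : ℕ) → n ≤ m → (∀ {i} → i < n → g i < f i) →
                      ColStrict (applyUpTo f m) (applyUpTo g n)
ColStrict-applyUpTo m       zero    _   _ = tt
ColStrict-applyUpTo (suc m) (suc n) n≤m g<f =
  g<f (s≤s z≤n) , ColStrict-applyUpTo m n (s≤s⁻¹ n≤m) (g<f ∘ s≤s)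

-- Strict plane partitions and their ideals

-- Row c of ρ lists the thresholds of the terms x2^b x3^c, b = 0, 1, …; entries
-- outside the shape read as 0.
entry : List (List ℕ) → ℕ → ℕ → ℕ
entry ρ b c = at 0 (at [] ρ c) b

record IsStrictPlanePartition (ρ : List (List ℕ)) : Set where
  field
    lengths-decreasing : Linked _>_ (map length ρ)
    lengths-positive   : All (0 <_) (map length ρ)
    entries-positive   : All (All (0 <_)) ρ
    rows-decreasing    : All (Linked _>_) ρ
    columns-decreasing : Linked ColStrict ρ

isStrictPlanePartition : ∀ {p h k ρ} → IsPP p h k ρ → IsStrictPlanePartition ρ
isStrictPlanePartition ((lengths↓ , lengths>0 , _ , _) , entries>0 , rows↓ , columns↓ , _) =
  record
    { lengths-decreasing = lengths↓
    ; lengths-positive   = lengths>0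
    ; entries-positive   = entries>0
    ; rows-decreasing    = rows↓
    ; columns-decreasing = columns↓
    }

toIsPP : ∀ {p h k ρ} → IsStrictPlanePartition ρ →
         sum (map sum ρ) ≡ p → sum (map length ρ) ≡ h → length ρ ≡ k → IsPP p h k ρ
toIsPP {ρ = ρ} P sum≡p sum≡h length≡k =
  (lengths-decreasing , lengths-positive , trans (length-map length ρ) length≡k , sum≡h)
  , entries-positive , rows-decreasing , columns-decreasing , sum≡p
  where open IsStrictPlanePartition P

Bool-ext : {x y : Bool} → (x ≡ true ⇔ y ≡ true) → x ≡ y
Bool-ext {false} {false} _       = refl
Bool-ext {false} {true}  x⇔y     = from x⇔y refl
Bool-ext {true}  {false} x⇔y     = sym (to x⇔y refl)
Bool-ext {true}  {true}  _       = refl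

idealOf : List (List ℕ) → Term → Bool
idealOf ρ (a , b , c) = entry ρ b c ≤ᵇ a

≤ᵇ≡true⇔ : ∀ m n → ((m ≤ᵇ n) ≡ true) ⇔ (m ≤ n)
≤ᵇ≡true⇔ m n = ⇔.trans (⇔.sym T-≡) (mk⇔ (≤ᵇ⇒≤ m n) ≤⇒≤ᵇ)

≤ᵇ≡false⇔ : ∀ m n → ((m ≤ᵇ n) ≡ false) ⇔ (n < m)
≤ᵇ≡false⇔ m n = mk⇔
  (λ m≰n → ≰⇒> (λ m≤n → not-¬ (from (≤ᵇ≡true⇔ m n) m≤n) m≰n))
  (λ n<m → ¬-not (λ m≤n → <⇒≱ n<m (to (≤ᵇ≡true⇔ m n) m≤n)))

stable⇒monomialIdeal : {J : Term → Bool} → IsStable J →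
  (∀ a b c → J (a , b , c) ≡ true → J (suc a , b , c) ≡ true) → IsMonomialIdeal J
stable⇒monomialIdeal (stable₁ , _) x1-closed a b c τ∈J =
  x1-closed a b c τ∈J , stable₁ a b c (x1-closed a b c τ∈J)

entry-≤ : ∀ {ρ σ} → (∀ t → idealOf σ t ≡ true → idealOf ρ t ≡ true) →
          ∀ b c → entry ρ b c ≤ entry σ b c
entry-≤ {ρ} {σ} σ⊆ρ b c =
  to (≤ᵇ≡true⇔ (entry ρ b c) e) (σ⊆ρ (e , b , c) (from (≤ᵇ≡true⇔ e e) ≤-refl))
  where
  e : ℕ
  e = entry σ b c

idealOf-injective : ∀ {ρ σ} → IsStrictPlanePartition ρ → IsStrictPlanePartition σ →
                    (∀ t → idealOf ρ t ≡ idealOf σ t) → ρ ≡ σ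
idealOf-injective {ρ} {σ} P Q same =
  at-ext {P = λ r → 0 < length r} (λ ())
    (All.map⁻ (lengths-positive P)) (All.map⁻ (lengths-positive Q))
    (λ c → at-ext {P = 0 <_} (λ ())
      (All-at (entries-positive P) [] c) (All-at (entries-positive Q) [] c)
      (λ b → ≤-antisym (entry-≤ {ρ} {σ} (λ t → trans (same t)) b c)
                       (entry-≤ {σ} {ρ} (λ t → trans (sym (same t))) b c)))
  where open IsStrictPlanePartition

-- Enumerating N(J) for the ideal of a plane partition

stack : (X → List A) → (A → A) → List X → List A
stack f s []       = []
stack f s (x ∷ xs) = f x ++ map s (stack f s xs)

length-stack : {f : X → List A} {s : A → A} (g : X → ℕ) → (∀ x → length (f x) ≡ g x) →
               ∀ xs → length (stack f s xs) ≡ sum (map g xs)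
length-stack g len-f []                    = refl
length-stack {f = f} {s} g len-f (x ∷ xs) = begin
  length (f x ++ map s (stack f s xs))
    ≡⟨ length-++ (f x) ⟩
  length (f x) + length (map s (stack f s xs))
    ≡⟨ cong₂ _+_ (len-f x) (length-map s (stack f s xs)) ⟩
  g x + length (stack f s xs)
    ≡⟨ cong (g x +_) (length-stack g len-f xs) ⟩
  g x + sum (map g xs)
    ∎
  where open ≡-Reasoning

Unique-stack : {f : X → List A} {s : A → A} → (∀ x → Unique (f x)) →
               (∀ {u v} → s u ≡ s v → u ≡ v) → (∀ x {t u} → t ∈ f x → t ≢ s u) →
               ∀ xs → Unique (stack f s xs)
Unique-stack unique-f s-injective disjoint []       = []
Unique-stack {s = s} unique-f s-injective disjoint (x ∷ xs) =
  ++⁺ (unique-f x) (map⁺ s-injective (Unique-stack unique-f s-injective disjoint xs))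
      (λ (t∈fx , t∈shifted) →
         let (_ , _ , t≡su) = ∈-map⁻ s t∈shifted in disjoint x t∈fx t≡su)

shift₂ shift₃ : Term → Term
shift₂ (a , b , c) = a , suc b , c
shift₃ (a , b , c) = a , b , suc c

shift₂-injective : ∀ {t u} → shift₂ t ≡ shift₂ u → t ≡ u
shift₂-injective {_ , _ , _} {_ , _ , _} refl = refl

shift₃-injective : ∀ {t u} → shift₃ t ≡ shift₃ u → t ≡ u
shift₃-injective {_ , _ , _} {_ , _ , _} refl = refl

column : ℕ → List Term
column r = map (λ a → a , 0 , 0) (upTo r)

rowTerms : List ℕ → List Term
rowTerms = stack column shift₂

normalTerms : List (List ℕ) → List Term
normalTerms = stack rowTerms shift₃

∈-column⁻ : ∀ r {a b c} → (a , b , c) ∈ column r → a < r × b ≡ 0 × c ≡ 0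
∈-column⁻ r t∈ with ∈-map⁻ _ t∈
... | _ , a∈ , refl = ∈-upTo⁻ a∈ , refl , refl

∈-rowTerms⁻ : ∀ rs {a b c} → (a , b , c) ∈ rowTerms rs → a < at 0 rs b × c ≡ 0
∈-rowTerms⁻ (r ∷ rs) t∈ with ∈-++⁻ (column r) t∈
... | inj₁ t∈column with ∈-column⁻ r t∈column
...   | a<r , refl , refl = a<r , refl
∈-rowTerms⁻ (r ∷ rs) t∈ | inj₂ t∈shifted with ∈-map⁻ shift₂ t∈shifted
...   | (_ , _ , _) , u∈ , refl = ∈-rowTerms⁻ rs u∈

∈-rowTerms⁺ : ∀ rs {a} b → a < at 0 rs b → (a , b , 0) ∈ rowTerms rs
∈-rowTerms⁺ (r ∷ rs) zero    a<r = ∈-++⁺ˡ (∈-map⁺ _ (∈-upTo⁺ a<r))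
∈-rowTerms⁺ (r ∷ rs) (suc b) a<e = ∈-++⁺ʳ (column r) (∈-map⁺ shift₂ (∈-rowTerms⁺ rs b a<e))

∈-normalTerms⁻ : ∀ ρ {a b c} → (a , b , c) ∈ normalTerms ρ → a < entry ρ b c
∈-normalTerms⁻ (r ∷ ρ) t∈ with ∈-++⁻ (rowTerms r) t∈
... | inj₁ t∈row with ∈-rowTerms⁻ r t∈row
...   | a<e , refl = a<e
∈-normalTerms⁻ (r ∷ ρ) t∈ | inj₂ t∈shifted with ∈-map⁻ shift₃ t∈shifted
...   | (_ , _ , _) , u∈ , refl = ∈-normalTerms⁻ ρ u∈

∈-normalTerms⁺ : ∀ ρ {a} b c → a < entry ρ b c → (a , b , c) ∈ normalTerms ρ
∈-normalTerms⁺ (r ∷ ρ) b zero    a<e = ∈-++⁺ˡ (∈-rowTerms⁺ r b a<e)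
∈-normalTerms⁺ (r ∷ ρ) b (suc c) a<e =
  ∈-++⁺ʳ (rowTerms r) (∈-map⁺ shift₃ (∈-normalTerms⁺ ρ b c a<e))

∈-normalTerms⇔∉idealOf : ∀ ρ t → (t ∈ normalTerms ρ) ⇔ (idealOf ρ t ≡ false)
∈-normalTerms⇔∉idealOf ρ (a , b , c) =
  ⇔.trans (mk⇔ (∈-normalTerms⁻ ρ) (∈-normalTerms⁺ ρ b c)) (⇔.sym (≤ᵇ≡false⇔ (entry ρ b c) a))

Unique-normalTerms : ∀ ρ → Unique (normalTerms ρ)
Unique-normalTerms = Unique-stack (Unique-stack Unique-column shift₂-injective column∌shift₂)
                                  shift₃-injective rowTerms∌shift₃
  where
  Unique-column : ∀ r → Unique (column r)
  Unique-column r = map⁺ (cong proj₁) (upTo⁺ r)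
  column∌shift₂ : ∀ r {t u} → t ∈ column r → t ≢ shift₂ u
  column∌shift₂ r {_ , _ , _} {_ , _ , _} t∈ refl with ∈-column⁻ r t∈
  ... | _ , () , _
  rowTerms∌shift₃ : ∀ rs {t u} → t ∈ rowTerms rs → t ≢ shift₃ u
  rowTerms∌shift₃ rs {_ , _ , _} {_ , _ , _} t∈ refl with ∈-rowTerms⁻ rs t∈
  ... | _ , ()

length-normalTerms : ∀ ρ → length (normalTerms ρ) ≡ sum (map sum ρ)
length-normalTerms = length-stack sum length-rowTerms
  where
  length-column : ∀ r → length (column r) ≡ r
  length-column r = trans (length-map _ (upTo r)) (length-upTo r)
  length-rowTerms : ∀ rs → length (rowTerms rs) ≡ sum rs
  length-rowTerms rs = trans (length-stack id length-column rs) (cong sum (map-id rs))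

rowCells : List ℕ → List (ℕ × ℕ)
rowCells r = map (_, 0) (upTo (length r))

shiftCell : ℕ × ℕ → ℕ × ℕ
shiftCell (b , c) = b , suc c

cells : List (List ℕ) → List (ℕ × ℕ)
cells = stack rowCells shiftCell

∈-cells⁻ : ∀ ρ {b c} → (b , c) ∈ cells ρ → b < length (at [] ρ c)
∈-cells⁻ (r ∷ ρ) bc∈ with ∈-++⁻ (rowCells r) bc∈
... | inj₁ bc∈row with ∈-map⁻ _ bc∈row
...   | _ , b∈ , refl = ∈-upTo⁻ b∈
∈-cells⁻ (r ∷ ρ) bc∈ | inj₂ bc∈shifted with ∈-map⁻ shiftCell bc∈shifted
...   | (_ , _) , u∈ , refl = ∈-cells⁻ ρ u∈

∈-cells⁺ : ∀ ρ b c → b < length (at [] ρ c) → (b , c) ∈ cells ρ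
∈-cells⁺ (r ∷ ρ) b zero    b<len = ∈-++⁺ˡ (∈-map⁺ _ (∈-upTo⁺ b<len))
∈-cells⁺ (r ∷ ρ) b (suc c) b<len = ∈-++⁺ʳ (rowCells r) (∈-map⁺ shiftCell (∈-cells⁺ ρ b c b<len))

Unique-cells : ∀ ρ → Unique (cells ρ)
Unique-cells = Unique-stack (λ r → map⁺ (cong proj₁) (upTo⁺ (length r)))
                            (λ { refl → refl }) rowCells∌shiftCell
  where
  rowCells∌shiftCell : ∀ r {bc bc'} → bc ∈ rowCells r → bc ≢ shiftCell bc'
  rowCells∌shiftCell r {bc' = _ , _} bc∈ refl with ∈-map⁻ _ bc∈
  ... | _ , _ , ()

length-cells : ∀ ρ → length (cells ρ) ≡ sum (map length ρ)
length-cells = length-stack length λ r →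
  trans (length-map _ (upTo (length r))) (length-upTo (length r))

module StrictPlanePartition {ρ : List (List ℕ)} (P : IsStrictPlanePartition ρ) where
  open IsStrictPlanePartition P

  entry-suc₂ : ∀ b c → entry ρ (suc b) c ≤ pred (entry ρ b c)
  entry-suc₂ b c = Linked>-at (All-at rows-decreasing [] c) b

  entry-suc₃ : ∀ b c → entry ρ b (suc c) ≤ pred (entry ρ b c)
  entry-suc₃ b c = ColStrict-at _ _ (Linked-at columns-decreasing (λ _ → tt) c) b

  rowLength-suc : ∀ c → length (at [] ρ (suc c)) ≤ pred (length (at [] ρ c))
  rowLength-suc c =
    subst₂ (λ m n → m ≤ pred n) (at-map length [] ρ (suc c)) (at-map length [] ρ c)
           (Linked>-at lengths-decreasing c)

  entry-pos⇔ : ∀ b c → 0 < entry ρ b c ⇔ b < length (at [] ρ c)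
  entry-pos⇔ b c = mk⇔ (at-<length {P = 0 <_} (at [] ρ c) (λ ()))
                       (All-at-< (All-at entries-positive [] c))

  rowLength-pos⇔ : ∀ c → 0 < length (at [] ρ c) ⇔ c < length ρ
  rowLength-pos⇔ c = mk⇔ (at-<length {P = λ r → 0 < length r} ρ (λ ()))
                         (All-at-< (All.map⁻ lengths-positive))

  entry-pos-suc₃⇒suc₂ : ∀ b c → 0 < entry ρ b (suc c) → 0 < entry ρ (suc b) c
  entry-pos-suc₃⇒suc₂ b c pos = from (entry-pos⇔ (suc b) c)
    (≤pred⇒< (s≤s z≤n) (≤-trans (to (entry-pos⇔ b (suc c)) pos) (rowLength-suc c)))

  isStable : IsStable (idealOf ρ)
  isStable = stable₁ , stable₂
    where
    stable₁ : ∀ a b c → idealOf ρ (suc a , b , c) ≡ true →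
              idealOf ρ (a , suc b , c) ≡ true × idealOf ρ (a , b , suc c) ≡ true
    stable₁ a b c x1τ∈J =
      from (≤ᵇ≡true⇔ _ a) (≤-trans (entry-suc₂ b c) (pred-mono-≤ e≤1+a)) ,
      from (≤ᵇ≡true⇔ _ a) (≤-trans (entry-suc₃ b c) (pred-mono-≤ e≤1+a))
      where
      e≤1+a : entry ρ b c ≤ suc a
      e≤1+a = to (≤ᵇ≡true⇔ (entry ρ b c) (suc a)) x1τ∈J
    stable₂ : ∀ b c → idealOf ρ (0 , suc b , c) ≡ true → idealOf ρ (0 , b , suc c) ≡ true
    stable₂ b c τ∈J = from (≤ᵇ≡true⇔ _ 0) (≮⇒≥ (λ pos →
      <⇒≱ (entry-pos-suc₃⇒suc₂ b c pos) (to (≤ᵇ≡true⇔ (entry ρ (suc b) c) 0) τ∈J)))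

  isMonomialIdeal : IsMonomialIdeal (idealOf ρ)
  isMonomialIdeal = stable⇒monomialIdeal isStable λ a b c τ∈J →
    from (≤ᵇ≡true⇔ _ (suc a)) (m≤n⇒m≤1+n (to (≤ᵇ≡true⇔ (entry ρ b c) a) τ∈J))

  μ2-normalTerms : μ2 (normalTerms ρ) ≡ sum (map length ρ)
  μ2-normalTerms =
    trans (length-deduplicate (≡-dec _≟_ _≟_) (Unique-cells ρ) (mk⇔ into onto)) (length-cells ρ)
    where
    into : ∀ {bc} → bc ∈ map proj23 (normalTerms ρ) → bc ∈ cells ρ
    into bc∈ with ∈-map⁻ proj23 bc∈
    ... | (a , b , c) , t∈ , refl =
      ∈-cells⁺ ρ b c (to (entry-pos⇔ b c) (≤-<-trans z≤n (∈-normalTerms⁻ ρ t∈)))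
    onto : ∀ {bc} → bc ∈ cells ρ → bc ∈ map proj23 (normalTerms ρ)
    onto {b , c} bc∈ =
      ∈-map⁺ proj23 (∈-normalTerms⁺ ρ b c (from (entry-pos⇔ b c) (∈-cells⁻ ρ bc∈)))

  μ3-normalTerms : μ3 (normalTerms ρ) ≡ length ρ
  μ3-normalTerms =
    trans (length-deduplicate _≟_ (upTo⁺ (length ρ)) (mk⇔ into onto)) (length-upTo (length ρ))
    where
    into : ∀ {c} → c ∈ map proj3 (normalTerms ρ) → c ∈ upTo (length ρ)
    into c∈ with ∈-map⁻ proj3 c∈
    ... | (a , b , c) , t∈ , refl = ∈-upTo⁺ (to (rowLength-pos⇔ c)
      (≤-<-trans z≤n (to (entry-pos⇔ b c) (≤-<-trans z≤n (∈-normalTerms⁻ ρ t∈)))))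
    onto : ∀ {c} → c ∈ upTo (length ρ) → c ∈ map proj3 (normalTerms ρ)
    onto {c} c∈ = ∈-map⁺ proj3 (∈-normalTerms⁺ ρ 0 c
      (from (entry-pos⇔ 0 c) (from (rowLength-pos⇔ c) (∈-upTo⁻ c∈))))

  hasBarList : ∀ {p h k} → sum (map sum ρ) ≡ p → sum (map length ρ) ≡ h → length ρ ≡ k →
               HasFiniteNWithBarList (idealOf ρ) p h k
  hasBarList sum≡p sum≡h length≡k =
    normalTerms ρ , Unique-normalTerms ρ , ∈-normalTerms⇔∉idealOf ρ ,
    trans (length-normalTerms ρ) sum≡p , trans μ2-normalTerms sum≡h , trans μ3-normalTerms length≡k

toStableIdeal : ∀ {p h k} → PP p h k → StableIdeal p h k
toStableIdeal (ρ , pp@((_ , _ , length≡k , sum≡h) , _ , _ , _ , sum≡p)) =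
  idealOf ρ , isMonomialIdeal , isStable ,
  hasBarList sum≡p sum≡h (trans (sym (length-map length ρ)) length≡k)
  where open StrictPlanePartition (isStrictPlanePartition pp)

barList-unique : ∀ {J J' : Term → Bool} {p h k p' h' k'} → (∀ t → J t ≡ J' t) →
                 HasFiniteNWithBarList J p h k → HasFiniteNWithBarList J' p' h' k' →
                 p ≡ p' × h ≡ h' × k ≡ k'
barList-unique J≡J' (M , M! , M-spec , μ1≡p , μ2≡h , μ3≡k)
                    (M' , M'! , M'-spec , μ1≡p' , μ2≡h' , μ3≡k') =
  trans (sym μ1≡p) (trans (length-unique M! M'! M∼M') μ1≡p') ,
  trans (sym μ2≡h) (trans (length-deduplicate-map-cong (≡-dec _≟_ _≟_) proj23 M∼M') μ2≡h') ,
  trans (sym μ3≡k) (trans (length-deduplicate-map-cong _≟_ proj3 M∼M') μ3≡k')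
  where
  M∼M' : M ∼[ set ] M'
  M∼M' {t} = ⇔.trans (M-spec t)
    (⇔.trans (mk⇔ (trans (sym (J≡J' t))) (trans (J≡J' t))) (⇔.sym (M'-spec t)))

-- The plane partition of a stable ideal

UpwardClosed : (ℕ → Bool) → Set
UpwardClosed f = ∀ i → f i ≡ true → f (suc i) ≡ true

upwardClosed-≤ : ∀ {f i j} → UpwardClosed f → i ≤ j → f i ≡ true → f j ≡ true
upwardClosed-≤ {f} {i} f↑ i≤j fi = go (≤⇒≤′ i≤j)
  where
  go : ∀ {j} → i ≤′ j → f j ≡ true
  go (≤′-reflexive refl) = fi
  go (≤′-step i≤′j)      = f↑ _ (go i≤′j)

threshold : (ℕ → Bool) → ℕ → ℕ
threshold f zero    = 0
threshold f (suc n) = if f 0 then 0 else suc (threshold (f ∘ suc) n)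

threshold-≤⇔ : ∀ {f n} → UpwardClosed f → f n ≡ true →
               ∀ i → (f i ≡ true) ⇔ (threshold f n ≤ i)
threshold-≤⇔ {f} {zero} f↑ fn i = mk⇔ (λ _ → z≤n) (λ _ → upwardClosed-≤ f↑ z≤n fn)
threshold-≤⇔ {f} {suc n} f↑ fn i with f 0 in f0
... | true = mk⇔ (λ _ → z≤n) (λ _ → upwardClosed-≤ f↑ z≤n f0)
threshold-≤⇔ {f} {suc n} f↑ fn zero    | false =
  mk⇔ (λ f0≡true → ⊥-elim (not-¬ f0≡true f0)) (λ ())
threshold-≤⇔ {f} {suc n} f↑ fn (suc i) | false =
  mk⇔ (s≤s ∘ to shifted) (from shifted ∘ s≤s⁻¹)
  where shifted = threshold-≤⇔ {f ∘ suc} {n} (f↑ ∘ suc) fn i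

degree : Term → ℕ
degree (a , b , c) = a + b + c

module FromStableIdeal (J : Term → Bool) (ideal : IsMonomialIdeal J) (stable : IsStable J)
                       (M : List Term) (M-spec : ∀ t → (t ∈ M) ⇔ (J t ≡ false)) where

  bound : ℕ
  bound = suc (sum (map degree M))

  ∈J-if-bound≤degree : ∀ t → bound ≤ degree t → J t ≡ true
  ∈J-if-bound≤degree t bound≤deg = ¬-not λ t∉J →
    <⇒≱ (s≤s (∈⇒≤sum (∈-map⁺ degree (from (M-spec t) t∉J)))) bound≤deg

  least₁ : ℕ → ℕ → ℕ
  least₁ b c = threshold (λ a → J (a , b , c)) bound

  least₂ : ℕ → ℕ
  least₂ c = threshold (λ b → J (0 , b , c)) bound

  least₃ : ℕ
  least₃ = threshold (λ c → J (0 , 0 , c)) bound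

  ∈J⇔least₁≤ : ∀ a b c → J (a , b , c) ≡ true ⇔ least₁ b c ≤ a
  ∈J⇔least₁≤ a b c =
    threshold-≤⇔ (λ a → proj₁ ∘ ideal a b c)
      (∈J-if-bound≤degree _ (≤-trans (m≤m+n bound b) (m≤m+n (bound + b) c))) a

  ∈J⇔least₂≤ : ∀ b c → J (0 , b , c) ≡ true ⇔ least₂ c ≤ b
  ∈J⇔least₂≤ b c =
    threshold-≤⇔ (λ b → proj₁ ∘ proj₂ ∘ ideal 0 b c) (∈J-if-bound≤degree _ (m≤m+n bound c)) b

  ∈J⇔least₃≤ : ∀ c → J (0 , 0 , c) ≡ true ⇔ least₃ ≤ c
  ∈J⇔least₃≤ c =
    threshold-≤⇔ (λ c → proj₂ ∘ proj₂ ∘ ideal 0 0 c) (∈J-if-bound≤degree _ ≤-refl) c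

  least₁-pos⇔ : ∀ b c → 0 < least₁ b c ⇔ b < least₂ c
  least₁-pos⇔ b c = ≤⇔≤⇒>⇔> (⇔.trans (⇔.sym (∈J⇔least₁≤ 0 b c)) (∈J⇔least₂≤ b c))

  least₂-pos⇔ : ∀ c → 0 < least₂ c ⇔ c < least₃
  least₂-pos⇔ c = ≤⇔≤⇒>⇔> (⇔.trans (⇔.sym (∈J⇔least₂≤ 0 c)) (∈J⇔least₃≤ c))

  -- Stability applied to the term of J just above a threshold, e.g. x1^(e+1) x2^b x3^c
  -- with e + 1 ≥ least₁ b c, shows that the neighbouring threshold is at most e.
  least₁-suc₂ : ∀ b c → least₁ (suc b) c ≤ pred (least₁ b c)
  least₁-suc₂ b c = to (∈J⇔least₁≤ _ (suc b) c)
    (proj₁ (proj₁ stable _ b c (from (∈J⇔least₁≤ _ b c) (n≤suc[pred[n]] (least₁ b c)))))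

  least₁-suc₃ : ∀ b c → least₁ b (suc c) ≤ pred (least₁ b c)
  least₁-suc₃ b c = to (∈J⇔least₁≤ _ b (suc c))
    (proj₂ (proj₁ stable _ b c (from (∈J⇔least₁≤ _ b c) (n≤suc[pred[n]] (least₁ b c)))))

  least₂-suc : ∀ c → least₂ (suc c) ≤ pred (least₂ c)
  least₂-suc c = to (∈J⇔least₂≤ _ (suc c))
    (proj₂ stable _ c (from (∈J⇔least₂≤ _ c) (n≤suc[pred[n]] (least₂ c))))

  row : ℕ → List ℕ
  row c = applyUpTo (λ b → least₁ b c) (least₂ c)

  partition : List (List ℕ)
  partition = applyUpTo row least₃

  entry-partition : ∀ b c → entry partition b c ≡ least₁ b c
  entry-partition b c = begin
    at 0 (at [] partition c) b ≡⟨ cong (λ r → at 0 r b) (at-applyUpTo least₃ row-vanishes c) ⟩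
    at 0 (row c) b             ≡⟨ at-applyUpTo (least₂ c) least₁-vanishes b ⟩
    least₁ b c                 ∎
    where
    open ≡-Reasoning
    least₁-vanishes : ∀ b → least₂ c ≤ b → least₁ b c ≡ 0
    least₁-vanishes b le = n≤0⇒n≡0 (to (∈J⇔least₁≤ 0 b c) (from (∈J⇔least₂≤ b c) le))
    row-vanishes : ∀ c → least₃ ≤ c → row c ≡ []
    row-vanishes c le =
      cong (applyUpTo _) (n≤0⇒n≡0 (to (∈J⇔least₂≤ 0 c) (from (∈J⇔least₃≤ c) le)))

  idealOf-partition : ∀ t → idealOf partition t ≡ J t
  idealOf-partition (a , b , c) = trans (cong (_≤ᵇ a) (entry-partition b c))
    (Bool-ext (⇔.trans (≤ᵇ≡true⇔ (least₁ b c) a) (⇔.sym (∈J⇔least₁≤ a b c))))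

  isStrictPlanePartition-partition : IsStrictPlanePartition partition
  isStrictPlanePartition-partition = record
    { lengths-decreasing = Linked.map⁺ (Linked-applyUpTo row least₃ λ {c} 2+c≤ →
        subst₂ _>_ (sym (length-row c)) (sym (length-row (suc c))) (least₂-decreasing 2+c≤))
    ; lengths-positive = All.map⁺ (All.applyUpTo⁺₁ row least₃ λ {c} c< →
        subst (0 <_) (sym (length-row c)) (from (least₂-pos⇔ c) c<))
    ; entries-positive = All.applyUpTo⁺₁ row least₃ λ {c} _ →
        All.applyUpTo⁺₁ _ (least₂ c) λ {b} → from (least₁-pos⇔ b c)
    ; rows-decreasing = All.applyUpTo⁺₁ row least₃ λ {c} _ →
        Linked-applyUpTo _ (least₂ c) λ {b} 2+b≤ →
          ≤pred⇒< (from (least₁-pos⇔ (suc b) c) 2+b≤) (least₁-suc₂ b c)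
    ; columns-decreasing = Linked-applyUpTo row least₃ λ {c} 2+c≤ →
        ColStrict-applyUpTo (least₂ c) (least₂ (suc c)) (<⇒≤ (least₂-decreasing 2+c≤)) λ {b} b< →
          ≤pred⇒< (from (least₁-pos⇔ b (suc c)) b<) (least₁-suc₃ b c)
    }
    where
    length-row : ∀ c → length (row c) ≡ least₂ c
    length-row c = length-applyUpTo _ (least₂ c)
    least₂-decreasing : ∀ {c} → suc c < least₃ → least₂ (suc c) < least₂ c
    least₂-decreasing {c} 2+c≤ = ≤pred⇒< (from (least₂-pos⇔ (suc c)) 2+c≤) (least₂-suc c)

fromStableIdeal : ∀ {p h k} → StableIdeal p h k → PP p h k
fromStableIdeal {p} {h} {k} (J , ideal , stable , barList@(M , _ , M-spec , _)) =
  partition , toIsPP isStrictPlanePartition-partition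
                     (proj₁ sizes) (proj₁ (proj₂ sizes)) (proj₂ (proj₂ sizes))
  where
  open FromStableIdeal J ideal stable M M-spec
  open StrictPlanePartition isStrictPlanePartition-partition using (hasBarList)
  sizes : sum (map sum partition) ≡ p × sum (map length partition) ≡ h × length partition ≡ k
  sizes = barList-unique idealOf-partition (hasBarList refl refl refl) barList

toStableIdeal-fromStableIdeal : ∀ {p h k} (J : StableIdeal p h k) →
                                toStableIdeal (fromStableIdeal J) ≈J J
toStableIdeal-fromStableIdeal (J , ideal , stable , (M , _ , M-spec , _)) =
  FromStableIdeal.idealOf-partition J ideal stable M M-spec

mainTheorem12 : (p h k : ℕ) → 0 < p → 0 < h → 0 < k →
    Σ (PP p h k → StableIdeal p h k) λ f →
      (∀ x y → f x ≈J f y → proj₁ x ≡ proj₁ y)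
      × (∀ J → ∃ λ x → f x ≈J J)
mainTheorem12 p h k _ _ _ =
  toStableIdeal ,
  (λ (ρ , ρ-pp) (σ , σ-pp) →
     idealOf-injective (isStrictPlanePartition ρ-pp) (isStrictPlanePartition σ-pp)) ,
  (λ J → fromStableIdeal J , toStableIdeal-fromStableIdeal J)
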